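{- Let $t(n)$ be a sequence of natural numbers, let $\mathrm{GF}_t(z)=\sum_{i=0}^\infty t(i)z^i$ and let $R$ be the radius of convergence of $\mathrm{GF}_t(z)$ at zero. Let $b$ and $n$ be positive integers such that $b\ge 8$, $b^{ -1}<R$, and $t(r)<b^{r/3}$ for every integer $r\ge 1$. Then $$t(n)=\left\lfloor b^{n^2}\,\mathrm{GF}_t(b^{ -n})\right\rfloor \bmod b^n .$$
   Context: Natural numbers are the non-negative integers. $\mathrm{GF}_t(b^{ -n})$ denotes the (real) sum of the power series $\sum_{i\ge 0} t(i) b^{ -ni}$. For an integer $y\ge 1$, $x \bmod y$ denotes the least non-negative residue of $x$ modulo $y$. -}

module Defs where

open import Data.Nat as ℕ using (ℕ; zero; suc; NonZero)
open import Data.Nat.Properties using (m^n≢0)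
open import Data.Integer using (+_)
open import Data.Rational using (ℚ; _/_; _+_; _*_; _<_; _≤_; 0ℚ; 1ℚ)
open import Data.Product using (Σ; _×_)

qpow : ℚ → ℕ → ℚ
qpow q zero    = 1ℚ
qpow q (suc k) = q * qpow q k

ℕ→ℚ : ℕ → ℚ
ℕ→ℚ m = (+ m) / 1

-- "b^{-1} < R" where R = radius of convergence of Σ t(i) z^i,
-- with R = sup { r ≥ 0 : (t(i) r^i)_i is bounded }.
-- Since boundedness is downward closed and ℚ is dense, b^{-1} < R iff
-- some rational ρ > b^{-1} has (t(i) ρ^i) bounded.
InvLtRadius : (b : ℕ) → .{{NonZero b}} → (ℕ → ℕ) → Set
InvLtRadius b t =
  Σ ℚ λ ρ → ((+ 1) / b < ρ) × (Σ ℚ λ C → ∀ i → ℕ→ℚ (t i) * qpow ρ i ≤ C)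

-- the i-th term of b^{n²} · GF_t(b^{-n}), i.e. t(i) · b^{n²} / b^{n i}
term : (b : ℕ) → .{{NonZero b}} → ℕ → (ℕ → ℕ) → ℕ → ℚ
term b n t i =
  _/_ (+ (t i ℕ.* b ℕ.^ (n ℕ.* n))) (b ℕ.^ (n ℕ.* i)) {{m^n≢0 b (n ℕ.* i)}}

partial : (b : ℕ) → .{{NonZero b}} → ℕ → (ℕ → ℕ) → ℕ → ℚ
partial b n t zero    = 0ℚ
partial b n t (suc N) = partial b n t N + term b n t N

-- IsFloorScaledGF b n t m : the series b^{n²} GF_t(b^{-n}) = Σ_i term i
-- (nonnegative terms, so its value is the supremum S of the partial sums)
-- converges and ⌊S⌋ = m, i.e.  m ≤ S < m + 1, expressed via rationals:
--   * m ≤ S : every rational q < m is exceeded by some partial sum;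
--   * S < m+1 : some rational q < m+1 bounds all partial sums
--     (this also gives convergence).
IsFloorScaledGF : (b : ℕ) → .{{NonZero b}} → ℕ → (ℕ → ℕ) → ℕ → Set
IsFloorScaledGF b n t m =
  (∀ (q : ℚ) → q < ℕ→ℚ m → Σ ℕ λ N → q < partial b n t N)
  × (Σ ℚ λ q → (q < ℕ→ℚ (suc m)) × (∀ N → partial b n t N ≤ q))

-- For i ≤ n the term t(i) b^{n²-ni} of b^{n²} GF_t(b^{-n}) is a natural number, and all of
-- them except t(n) are multiples of b^n; since t(n)³ < b^n, the sum m of these terms has
-- m mod b^n = t(n). For i = n+1+j the growth bound t(i)³ < b^i together with b ≥ 8 gives
-- term i ≤ 2/4^{j+1}, so the remaining terms add up to at most 2/3 < 1 and ⌊Σ⌋ = m.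
module Submission where

open import Defs
open import Data.Nat using (ℕ; NonZero; _≤_; _<_; _^_; _%_)
open import Data.Nat.Properties using (m^n≢0)
open import Data.Product using (Σ; _×_)
open import Relation.Binary.PropositionalEquality using (_≡_)

open import Data.Nat as ℕ using (zero; suc; z≤n; s≤s; _∸_; _<?_)
import Data.Nat.Properties as ℕₚ
open import Data.Nat.Divisibility using (_∣_; divides; ∣-trans; ∣m∣n⇒∣m+n; m∣m*n; n∣m*n)
open import Data.Nat.DivMod using ([m+kn]%n≡m%n; m<n⇒m%n≡m)
open import Data.Nat.Tactic.RingSolver using (solve-∀)
open import Data.Integer as ℤ using (+_)
import Data.Integer.Properties as ℤₚ
open import Data.Rational as ℚ using (ℚ; 0ℚ; _/_; toℚᵘ)
import Data.Rational.Properties as ℚₚ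
import Data.Rational.Unnormalised as ℚᵘ
import Data.Rational.Unnormalised.Properties as ℚᵘₚ
open import Data.Product using (_,_)
open import Relation.Binary.PropositionalEquality using (refl; sym; trans; cong; cong₂; subst; subst₂; module ≡-Reasoning)
open import Relation.Nullary using (yes; no; contradiction)

toℚᵘ-/ : ∀ a d .{{_ : NonZero d}} → toℚᵘ (+ a / d) ℚᵘ.≃ ℚᵘ.mkℚᵘ (+ a) (ℕ.pred d)
toℚᵘ-/ a (suc d) = ℚₚ.toℚᵘ-fromℚᵘ (ℚᵘ.mkℚᵘ (+ a) d)

*≤*⇒/≤/ : ∀ a d c e .{{_ : NonZero d}} .{{_ : NonZero e}} →
          a ℕ.* e ≤ c ℕ.* d → + a / d ℚ.≤ + c / e
*≤*⇒/≤/ a d@(suc _) c e@(suc _) ae≤cd = ℚₚ.toℚᵘ-cancel-≤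
  (ℚᵘₚ.≤-respˡ-≃ (ℚᵘₚ.≃-sym (toℚᵘ-/ a d)) (ℚᵘₚ.≤-respʳ-≃ (ℚᵘₚ.≃-sym (toℚᵘ-/ c e))
    (ℚᵘ.*≤* (subst₂ ℤ._≤_ (ℤₚ.pos-* a e) (ℤₚ.pos-* c d) (ℤ.+≤+ ae≤cd)))))

*<*⇒/</ : ∀ a d c e .{{_ : NonZero d}} .{{_ : NonZero e}} →
          a ℕ.* e < c ℕ.* d → + a / d ℚ.< + c / e
*<*⇒/</ a d@(suc _) c e@(suc _) ae<cd = ℚₚ.toℚᵘ-cancel-<
  (ℚᵘₚ.<-respˡ-≃ (ℚᵘₚ.≃-sym (toℚᵘ-/ a d)) (ℚᵘₚ.<-respʳ-≃ (ℚᵘₚ.≃-sym (toℚᵘ-/ c e))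
    (ℚᵘ.*<* (subst₂ ℤ._<_ (ℤₚ.pos-* a e) (ℤₚ.pos-* c d) (ℤ.+<+ ae<cd)))))

*≡*⇒/≡/ : ∀ a d c e .{{_ : NonZero d}} .{{_ : NonZero e}} →
          a ℕ.* e ≡ c ℕ.* d → + a / d ≡ + c / e
*≡*⇒/≡/ a d@(suc _) c e@(suc _) ae≡cd = ℚₚ.toℚᵘ-injective
  (ℚᵘₚ.≃-trans (toℚᵘ-/ a d) (ℚᵘₚ.≃-trans
    (ℚᵘ.*≡* (trans (sym (ℤₚ.pos-* a e)) (trans (cong +_ ae≡cd) (ℤₚ.pos-* c d))))
    (ℚᵘₚ.≃-sym (toℚᵘ-/ c e))))

/+/≡/ : ∀ a d c e .{{_ : NonZero d}} .{{_ : NonZero e}} →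
        + a / d ℚ.+ + c / e ≡ _/_ (+ (a ℕ.* e ℕ.+ c ℕ.* d)) (d ℕ.* e) {{ℕₚ.m*n≢0 d e}}
/+/≡/ a d@(suc _) c e@(suc _) = ℚₚ.toℚᵘ-injective
  (ℚᵘₚ.≃-trans (ℚₚ.toℚᵘ-homo-+ (+ a / d) (+ c / e))
  (ℚᵘₚ.≃-trans (ℚᵘₚ.+-cong (toℚᵘ-/ a d) (toℚᵘ-/ c e))
  (ℚᵘₚ.≃-trans (ℚᵘ.*≡* (cong (ℤ._* + (d ℕ.* e)) numerator))
    (ℚᵘₚ.≃-sym (toℚᵘ-/ (a ℕ.* e ℕ.+ c ℕ.* d) (d ℕ.* e) {{ℕₚ.m*n≢0 d e}})))))
  where
  numerator : + a ℤ.* + e ℤ.+ + c ℤ.* + d ≡ + (a ℕ.* e ℕ.+ c ℕ.* d)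
  numerator = trans (cong₂ ℤ._+_ (sym (ℤₚ.pos-* a e)) (sym (ℤₚ.pos-* c d)))
                    (sym (ℤₚ.pos-+ (a ℕ.* e) (c ℕ.* d)))

ℕ→ℚ-homo-+ : ∀ x y → ℕ→ℚ x ℚ.+ ℕ→ℚ y ≡ ℕ→ℚ (x ℕ.+ y)
ℕ→ℚ-homo-+ x y = trans (/+/≡/ x 1 y 1)
  (*≡*⇒/≡/ (x ℕ.* 1 ℕ.+ y ℕ.* 1) 1 (x ℕ.+ y) 1
    (cong (ℕ._* 1) (cong₂ ℕ._+_ (ℕₚ.*-identityʳ x) (ℕₚ.*-identityʳ y))))

0≤/ : ∀ a d .{{_ : NonZero d}} → 0ℚ ℚ.≤ + a / d
0≤/ a d = *≤*⇒/≤/ 0 1 a d z≤n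

p≤p+q : ∀ p {q} → 0ℚ ℚ.≤ q → p ℚ.≤ p ℚ.+ q
p≤p+q p 0≤q = ℚₚ.≤-trans (ℚₚ.≤-reflexive (sym (ℚₚ.+-identityʳ p))) (ℚₚ.+-monoʳ-≤ p 0≤q)

m≤m^[1+n] : ∀ m n → m ≤ m ^ suc n
m≤m^[1+n] zero    n = z≤n
m≤m^[1+n] (suc m) n = ℕₚ.m≤m*n (suc m) (suc m ^ n) {{m^n≢0 (suc m) n}}

^-distribʳ-* : ∀ m n k → (m ℕ.* n) ^ k ≡ m ^ k ℕ.* n ^ k
^-distribʳ-* m n zero    = refl
^-distribʳ-* m n (suc k) = trans (cong (m ℕ.* n ℕ.*_) (^-distribʳ-* m n k))
                                 (ℕₚ.[m*n]*[o*p]≡[m*o]*[n*p] m n (m ^ k) (n ^ k))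

^-cancelˡ-< : ∀ k {x y} → x ^ k < y ^ k → x < y
^-cancelˡ-< k {x} {y} xᵏ<yᵏ with x <? y
... | yes x<y = x<y
... | no  x≮y = contradiction xᵏ<yᵏ (ℕₚ.≤⇒≯ (ℕₚ.^-monoˡ-≤ k (ℕₚ.≮⇒≥ x≮y)))

m^n∣m^[n*[1+k]] : ∀ m n k → m ^ n ∣ m ^ (n ℕ.* suc k)
m^n∣m^[n*[1+k]] m n k = subst (m ^ n ∣_) (sym (begin
  m ^ (n ℕ.* suc k)       ≡⟨ cong (m ^_) (ℕₚ.*-suc n k) ⟩
  m ^ (n ℕ.+ n ℕ.* k)     ≡⟨ ℕₚ.^-distribˡ-+-* m n (n ℕ.* k) ⟩
  m ^ n ℕ.* m ^ (n ℕ.* k) ∎)) (m∣m*n (m ^ (n ℕ.* k)))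
  where open ≡-Reasoning

[2*4^j]^3≤b^[1+2j] : ∀ {b} → 8 ≤ b → ∀ j → (2 ℕ.* 4 ^ j) ^ 3 ≤ b ^ (1 ℕ.+ 2 ℕ.* j)
[2*4^j]^3≤b^[1+2j] {b} 8≤b j = begin
  (2 ℕ.* 4 ^ j) ^ 3     ≡⟨ ^-distribʳ-* 2 (4 ^ j) 3 ⟩
  8 ℕ.* (4 ^ j) ^ 3     ≡⟨ cong (8 ℕ.*_) (trans (ℕₚ.^-*-assoc 4 j 3) (cong (4 ^_) (ℕₚ.*-comm j 3))) ⟩
  8 ℕ.* 4 ^ (3 ℕ.* j)   ≡⟨ cong (8 ℕ.*_) (sym (ℕₚ.^-*-assoc 4 3 j)) ⟩
  8 ℕ.* 64 ^ j          ≤⟨ ℕₚ.*-mono-≤ 8≤b (ℕₚ.^-monoˡ-≤ j 64≤b²) ⟩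
  b ℕ.* (b ^ 2) ^ j     ≡⟨ cong (b ℕ.*_) (ℕₚ.^-*-assoc b 2 j) ⟩
  b ^ (1 ℕ.+ 2 ℕ.* j)   ∎
  where
  open ℕₚ.≤-Reasoning
  64≤b² : 64 ≤ b ^ 2
  64≤b² = subst (64 ≤_) (cong (b ℕ.*_) (sym (ℕₚ.*-identityʳ b))) (ℕₚ.*-mono-≤ 8≤b 8≤b)

[1+n+j]+[1+2j]≤3n[1+j] : ∀ n j → 1 ≤ n → suc (n ℕ.+ j) ℕ.+ (1 ℕ.+ 2 ℕ.* j) ≤ n ℕ.* suc j ℕ.* 3
[1+n+j]+[1+2j]≤3n[1+j] (suc n) j _ = subst (suc (suc n ℕ.+ j) ℕ.+ (1 ℕ.+ 2 ℕ.* j) ≤_) (expand n j) (ℕₚ.m≤m+n _ (2 ℕ.* n ℕ.+ 3 ℕ.* n ℕ.* j))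
  where
  expand : ∀ n j → suc (suc n ℕ.+ j) ℕ.+ (1 ℕ.+ 2 ℕ.* j) ℕ.+ (2 ℕ.* n ℕ.+ 3 ℕ.* n ℕ.* j)
                 ≡ suc n ℕ.* suc j ℕ.* 3
  expand = solve-∀

module _ (b : ℕ) .{{_ : NonZero b}} (n : ℕ) (t : ℕ → ℕ) where

  private
    instance
      b^n≢0 : NonZero (b ^ n)
      b^n≢0 = m^n≢0 b n

  headSum : ℕ → ℕ
  headSum zero    = 0
  headSum (suc j) = headSum j ℕ.+ t j ℕ.* b ^ (n ℕ.* (n ∸ j))

  term≡ℕ→ℚ : ∀ {j} → j ≤ n → term b n t j ≡ ℕ→ℚ (t j ℕ.* b ^ (n ℕ.* (n ∸ j)))
  term≡ℕ→ℚ {j} j≤n = *≡*⇒/≡/ (t j ℕ.* b ^ (n ℕ.* n)) (b ^ (n ℕ.* j)) (t j ℕ.* b ^ (n ℕ.* (n ∸ j))) 1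
                                      {{m^n≢0 b (n ℕ.* j)}} (begin
    t j ℕ.* b ^ (n ℕ.* n) ℕ.* 1                        ≡⟨ ℕₚ.*-identityʳ _ ⟩
    t j ℕ.* b ^ (n ℕ.* n)                              ≡⟨ cong (λ e → t j ℕ.* b ^ (n ℕ.* e)) (sym (ℕₚ.m∸n+n≡m j≤n)) ⟩
    t j ℕ.* b ^ (n ℕ.* ((n ∸ j) ℕ.+ j))                ≡⟨ cong (λ e → t j ℕ.* b ^ e) (ℕₚ.*-distribˡ-+ n (n ∸ j) j) ⟩
    t j ℕ.* b ^ (n ℕ.* (n ∸ j) ℕ.+ n ℕ.* j)            ≡⟨ cong (t j ℕ.*_) (ℕₚ.^-distribˡ-+-* b (n ℕ.* (n ∸ j)) (n ℕ.* j)) ⟩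
    t j ℕ.* (b ^ (n ℕ.* (n ∸ j)) ℕ.* b ^ (n ℕ.* j))    ≡⟨ sym (ℕₚ.*-assoc (t j) _ _) ⟩
    t j ℕ.* b ^ (n ℕ.* (n ∸ j)) ℕ.* b ^ (n ℕ.* j)      ∎)
    where open ≡-Reasoning

  partial≡headSum : ∀ {k} → k ≤ suc n → partial b n t k ≡ ℕ→ℚ (headSum k)
  partial≡headSum {zero}  _         = refl
  partial≡headSum {suc k} (s≤s k≤n) =
    trans (cong₂ ℚ._+_ (partial≡headSum (ℕₚ.m≤n⇒m≤1+n k≤n)) (term≡ℕ→ℚ k≤n)) (ℕ→ℚ-homo-+ (headSum k) _)

  b^n∣headSum : ∀ {j} → j ≤ n → b ^ n ∣ headSum j
  b^n∣headSum {zero}  _   = divides 0 refl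
  b^n∣headSum {suc j} j<n = ∣m∣n⇒∣m+n (b^n∣headSum (ℕₚ.<⇒≤ j<n))
    (∣-trans (subst (λ e → b ^ n ∣ b ^ (n ℕ.* e)) (sym (ℕₚ.+-∸-assoc 1 j<n)) (m^n∣m^[n*[1+k]] b n (n ∸ suc j)))
             (n∣m*n (t j)))

  headSum%b^n≡t : t n < b ^ n → headSum (suc n) % b ^ n ≡ t n
  headSum%b^n≡t tₙ<bⁿ = begin
    (headSum n ℕ.+ t n ℕ.* b ^ (n ℕ.* (n ∸ n))) % b ^ n ≡⟨ cong (λ e → (e ℕ.+ t n ℕ.* b ^ (n ℕ.* (n ∸ n))) % b ^ n) headSumₙ≡Kbⁿ ⟩
    (K ℕ.* b ^ n ℕ.+ t n ℕ.* b ^ (n ℕ.* (n ∸ n))) % b ^ n ≡⟨ cong (_% b ^ n) (ℕₚ.+-comm (K ℕ.* b ^ n) _) ⟩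
    (t n ℕ.* b ^ (n ℕ.* (n ∸ n)) ℕ.+ K ℕ.* b ^ n) % b ^ n ≡⟨ [m+kn]%n≡m%n _ K (b ^ n) ⟩
    (t n ℕ.* b ^ (n ℕ.* (n ∸ n))) % b ^ n                 ≡⟨ cong (_% b ^ n) tₙ*b⁰≡tₙ ⟩
    t n % b ^ n                                           ≡⟨ m<n⇒m%n≡m tₙ<bⁿ ⟩
    t n                                                   ∎
    where
    open ≡-Reasoning
    open _∣_ (b^n∣headSum {n} ℕₚ.≤-refl) renaming (quotient to K; equality to headSumₙ≡Kbⁿ)
    tₙ*b⁰≡tₙ : t n ℕ.* b ^ (n ℕ.* (n ∸ n)) ≡ t n
    tₙ*b⁰≡tₙ = trans (cong (λ e → t n ℕ.* b ^ (n ℕ.* e)) (ℕₚ.n∸n≡0 n))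
                     (trans (cong (λ e → t n ℕ.* b ^ e) (ℕₚ.*-zeroʳ n)) (ℕₚ.*-identityʳ (t n)))

  partial-mono : ∀ i d → partial b n t i ℚ.≤ partial b n t (d ℕ.+ i)
  partial-mono i zero    = ℚₚ.≤-refl
  partial-mono i (suc d) = ℚₚ.≤-trans (partial-mono i d) (p≤p+q _ (0≤/ (t (d ℕ.+ i) ℕ.* b ^ (n ℕ.* n)) (b ^ (n ℕ.* (d ℕ.+ i))) {{m^n≢0 b (n ℕ.* (d ℕ.+ i))}}))

  partial-telescope : (c : ℕ → ℚ) (s : ℕ) →
                      (∀ K → term b n t (s ℕ.+ K) ℚ.+ c (suc K) ℚ.≤ c K) →
                      ∀ K → partial b n t (s ℕ.+ K) ℚ.+ c K ℚ.≤ partial b n t s ℚ.+ c 0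
  partial-telescope c s step zero    rewrite ℕₚ.+-identityʳ s = ℚₚ.≤-refl
  partial-telescope c s step (suc K) rewrite ℕₚ.+-suc s K = ℚₚ.≤-trans
    (ℚₚ.≤-reflexive (ℚₚ.+-assoc (partial b n t (s ℕ.+ K)) (term b n t (s ℕ.+ K)) (c (suc K))))
    (ℚₚ.≤-trans (ℚₚ.+-monoʳ-≤ (partial b n t (s ℕ.+ K)) (step K)) (partial-telescope c s step K))

  t[1+n+j]*[2*4^j]≤b^[n*[1+j]] : 1 ≤ n → 8 ≤ b → ∀ j → t (suc n ℕ.+ j) ^ 3 < b ^ (suc n ℕ.+ j) →
                                 t (suc n ℕ.+ j) ℕ.* (2 ℕ.* 4 ^ j) ≤ b ^ (n ℕ.* suc j)
  t[1+n+j]*[2*4^j]≤b^[n*[1+j]] 1≤n 8≤b j tᵢ³<bⁱ = ℕₚ.<⇒≤ (^-cancelˡ-< 3 (begin-strict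
    (tᵢ ℕ.* (2 ℕ.* 4 ^ j)) ^ 3          ≡⟨ ^-distribʳ-* tᵢ _ 3 ⟩
    tᵢ ^ 3 ℕ.* (2 ℕ.* 4 ^ j) ^ 3        <⟨ ℕₚ.*-monoˡ-< _ {{m^n≢0 (2 ℕ.* 4 ^ j) 3 {{ℕₚ.m*n≢0 2 (4 ^ j) {{_}} {{m^n≢0 4 j}}}}}} tᵢ³<bⁱ ⟩
    b ^ i ℕ.* (2 ℕ.* 4 ^ j) ^ 3         ≤⟨ ℕₚ.*-monoʳ-≤ (b ^ i) ([2*4^j]^3≤b^[1+2j] 8≤b j) ⟩
    b ^ i ℕ.* b ^ (1 ℕ.+ 2 ℕ.* j)       ≡⟨ sym (ℕₚ.^-distribˡ-+-* b i (1 ℕ.+ 2 ℕ.* j)) ⟩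
    b ^ (i ℕ.+ (1 ℕ.+ 2 ℕ.* j))         ≤⟨ ℕₚ.^-monoʳ-≤ b ([1+n+j]+[1+2j]≤3n[1+j] n j 1≤n) ⟩
    b ^ (n ℕ.* suc j ℕ.* 3)             ≡⟨ sym (ℕₚ.^-*-assoc b (n ℕ.* suc j) 3) ⟩
    (b ^ (n ℕ.* suc j)) ^ 3             ∎))
    where
    i = suc n ℕ.+ j
    tᵢ = t i
    open ℕₚ.≤-Reasoning

  term[1+n+j]≤2/4^[1+j] : 1 ≤ n → 8 ≤ b → ∀ j → t (suc n ℕ.+ j) ^ 3 < b ^ (suc n ℕ.+ j) →
                          term b n t (suc n ℕ.+ j) ℚ.≤ _/_ (+ 2) (4 ^ suc j) {{m^n≢0 4 (suc j)}}
  term[1+n+j]≤2/4^[1+j] 1≤n 8≤b j tᵢ³<bⁱ =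
    *≤*⇒/≤/ (tᵢ ℕ.* bⁿⁿ) (b ^ (n ℕ.* i)) 2 (4 ^ suc j) {{m^n≢0 b (n ℕ.* i)}} {{m^n≢0 4 (suc j)}} (begin
      tᵢ ℕ.* bⁿⁿ ℕ.* (4 ℕ.* 4 ^ j)            ≡⟨ rearrange tᵢ bⁿⁿ (4 ^ j) ⟩
      2 ℕ.* (tᵢ ℕ.* (2 ℕ.* 4 ^ j) ℕ.* bⁿⁿ)    ≤⟨ ℕₚ.*-monoʳ-≤ 2 (ℕₚ.*-monoˡ-≤ bⁿⁿ (t[1+n+j]*[2*4^j]≤b^[n*[1+j]] 1≤n 8≤b j tᵢ³<bⁱ)) ⟩
      2 ℕ.* (b ^ (n ℕ.* suc j) ℕ.* bⁿⁿ)       ≡⟨ cong (2 ℕ.*_) (sym (ℕₚ.^-distribˡ-+-* b (n ℕ.* suc j) (n ℕ.* n))) ⟩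
      2 ℕ.* b ^ (n ℕ.* suc j ℕ.+ n ℕ.* n)     ≡⟨ cong (λ e → 2 ℕ.* b ^ e) (sym (ℕₚ.*-distribˡ-+ n (suc j) n)) ⟩
      2 ℕ.* b ^ (n ℕ.* (suc j ℕ.+ n))         ≡⟨ cong (λ e → 2 ℕ.* b ^ (n ℕ.* e)) (ℕₚ.+-comm (suc j) n) ⟩
      2 ℕ.* b ^ (n ℕ.* (n ℕ.+ suc j))         ≡⟨ cong (λ e → 2 ℕ.* b ^ (n ℕ.* e)) (ℕₚ.+-suc n j) ⟩
      2 ℕ.* b ^ (n ℕ.* i)                     ∎)
    where
    i = suc n ℕ.+ j
    tᵢ = t i
    bⁿⁿ = b ^ (n ℕ.* n)
    open ℕₚ.≤-Reasoning
    rearrange : ∀ a B p → a ℕ.* B ℕ.* (4 ℕ.* p) ≡ 2 ℕ.* (a ℕ.* (2 ℕ.* p) ℕ.* B)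
    rearrange = solve-∀

-- 2/(3·4^K) = Σ_{k>K} 2/4^k
geometricTail : ℕ → ℚ
geometricTail K = _/_ (+ 2) (3 ℕ.* 4 ^ K) {{ℕₚ.m*n≢0 3 (4 ^ K) {{_}} {{m^n≢0 4 K}}}}

2/4^[1+K]+geometricTail[1+K]≡geometricTail[K] : ∀ K →
  _/_ (+ 2) (4 ^ suc K) {{m^n≢0 4 (suc K)}} ℚ.+ geometricTail (suc K) ≡ geometricTail K
2/4^[1+K]+geometricTail[1+K]≡geometricTail[K] K = trans
  (/+/≡/ 2 q 2 (3 ℕ.* q) {{m^n≢0 4 (suc K)}} {{3q≢0}})
  (*≡*⇒/≡/ (2 ℕ.* (3 ℕ.* q) ℕ.+ 2 ℕ.* q) (q ℕ.* (3 ℕ.* q)) 2 (3 ℕ.* p)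
    {{ℕₚ.m*n≢0 q (3 ℕ.* q) {{m^n≢0 4 (suc K)}} {{3q≢0}}}} {{ℕₚ.m*n≢0 3 p {{_}} {{m^n≢0 4 K}}}}
    (cross p))
  where
  p = 4 ^ K
  q = 4 ^ suc K
  3q≢0 : NonZero (3 ℕ.* q)
  3q≢0 = ℕₚ.m*n≢0 3 q {{_}} {{m^n≢0 4 (suc K)}}
  cross : ∀ p → (2 ℕ.* (3 ℕ.* (4 ℕ.* p)) ℕ.+ 2 ℕ.* (4 ℕ.* p)) ℕ.* (3 ℕ.* p)
              ≡ 2 ℕ.* ((4 ℕ.* p) ℕ.* (3 ℕ.* (4 ℕ.* p)))
  cross = solve-∀

module _ (b : ℕ) .{{_ : NonZero b}} (n : ℕ) (t : ℕ → ℕ) (1≤n : 1 ≤ n) (8≤b : 8 ≤ b)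
         (t³<b^ : ∀ r → 1 ≤ r → t r ^ 3 < b ^ r) where

  private
    m = headSum b n t (suc n)

  partial≤m+2/3 : ∀ N → partial b n t N ℚ.≤ + (m ℕ.* 3 ℕ.+ 2) / 3
  partial≤m+2/3 N = begin
    partial b n t N                                  ≤⟨ partial-mono b n t N (suc n) ⟩
    partial b n t (suc n ℕ.+ N)                      ≤⟨ p≤p+q _ (0≤/ 2 (3 ℕ.* 4 ^ N) {{ℕₚ.m*n≢0 3 (4 ^ N) {{_}} {{m^n≢0 4 N}}}}) ⟩
    partial b n t (suc n ℕ.+ N) ℚ.+ geometricTail N  ≤⟨ partial-telescope b n t geometricTail (suc n) tailStep N ⟩
    partial b n t (suc n) ℚ.+ geometricTail 0        ≡⟨ cong (ℚ._+ geometricTail 0) (partial≡headSum b n t ℕₚ.≤-refl) ⟩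
    ℕ→ℚ m ℚ.+ + 2 / 3                                ≡⟨ /+/≡/ m 1 2 3 ⟩
    + (m ℕ.* 3 ℕ.+ 2 ℕ.* 1) / 3                      ≡⟨ cong (λ e → + (m ℕ.* 3 ℕ.+ e) / 3) (ℕₚ.*-identityʳ 2) ⟩
    + (m ℕ.* 3 ℕ.+ 2) / 3                            ∎
    where
    open ℚₚ.≤-Reasoning
    tailStep : ∀ K → term b n t (suc n ℕ.+ K) ℚ.+ geometricTail (suc K) ℚ.≤ geometricTail K
    tailStep K = ℚₚ.≤-trans
      (ℚₚ.+-monoˡ-≤ (geometricTail (suc K))
        (term[1+n+j]≤2/4^[1+j] b n t 1≤n 8≤b K (t³<b^ (suc n ℕ.+ K) (s≤s z≤n))))
      (ℚₚ.≤-reflexive (2/4^[1+K]+geometricTail[1+K]≡geometricTail[K] K))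

theorem4p2 : (t : ℕ → ℕ) (b n : ℕ) .{{_ : NonZero b}} → 1 ≤ n → 8 ≤ b
    → InvLtRadius b t
    → (∀ r → 1 ≤ r → t r ^ 3 < b ^ r)
    → Σ ℕ λ m → IsFloorScaledGF b n t m × (t n ≡ _%_ m (b ^ n) {{m^n≢0 b n}})
theorem4p2 t b n 1≤n 8≤b _ t³<b^ = m , (m≤Σ , Σ<m+1) , sym (headSum%b^n≡t b n t tₙ<bⁿ)
  where
  m = headSum b n t (suc n)
  tₙ<bⁿ : t n < b ^ n
  tₙ<bⁿ = ℕₚ.≤-<-trans (m≤m^[1+n] (t n) 2) (t³<b^ n 1≤n)
  m≤Σ : ∀ q → q ℚ.< ℕ→ℚ m → Σ ℕ λ N → q ℚ.< partial b n t N
  m≤Σ q q<m = suc n , subst (q ℚ.<_) (sym (partial≡headSum b n t ℕₚ.≤-refl)) q<m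
  Σ<m+1 : Σ ℚ λ q → (q ℚ.< ℕ→ℚ (suc m)) × (∀ N → partial b n t N ℚ.≤ q)
  Σ<m+1 = + (m ℕ.* 3 ℕ.+ 2) / 3
        , *<*⇒/</ (m ℕ.* 3 ℕ.+ 2) 3 (suc m) 1 (ℕₚ.≤-reflexive (cross m))
        , partial≤m+2/3 b n t 1≤n 8≤b t³<b^
    where
    cross : ∀ m → suc ((m ℕ.* 3 ℕ.+ 2) ℕ.* 1) ≡ suc m ℕ.* 3
    cross = solve-∀
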